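{- Let $\Lambda$ be a normal greedoid over a finite alphabet $\Sigma$ possessing an aligned polymatroid representation $\rho$. Then for every $\alpha\in\Lambda$ and every $y\in\Sigma\setminus\kappa[\alpha]$ there exists a word $\beta\in\Sigma^*$ (possibly empty) such that $\alpha\beta y\in\Lambda$.
   Context: Words: $\Sigma^*$ finite words over $\Sigma$ (including the empty word); simple = no repeated letter; $\tilde\alpha$ the set of letters, $|\alpha|$ the length. A greedoid over $\Sigma$ is a nonempty language $\Lambda\subseteq\Sigma^*$ of simple words with (i) $\alpha\beta\in\Lambda\Rightarrow\alpha\in\Lambda$, (ii) if $\alpha,\beta\in\Lambda$, $|\alpha|>|\beta|$, then $\beta x\in\Lambda$ for some $x\in\tilde\alpha$. Normal: every letter occurs in some word of $\Lambda$. Greedoid rank $r(X)=\max\{|\beta|:\beta\in\Lambda,\tilde\beta\subseteq X\}$, greedoid span $\sigma_r(X)=\{y:r(X\cup\{y\})=r(X)\}$, kernel $\kappa(X)=\bigcup\{\tilde\beta:\beta\in\Lambda,\tilde\beta\subseteq\sigma_r(X)\}$, $\kappa[\alpha]:=\kappa(\tilde\alpha)$. Continuations $\Gamma[\alpha]=\{x:\alpha x\in\Lambda\}$; flats are classes of $\alpha\sim\beta\iff\Gamma[\alpha]=\Gamma[\beta]$, written $[\alpha]$, ordered by $[\alpha]\sqsubset[\beta]$ iff some nonempty $\beta'$ has $\alpha\beta'\in\Lambda$, $\alpha\beta'\sim\beta$; this poset is $\mathcal{L}_\Lambda$ with covering relation $\prec$. A polymatroid rank function is $\rho:2^\Sigma\to\mathbb{R}$,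 $\rho(\emptyset)=0$, monotone, submodular; span $\sigma_\rho(X)=\{y:\rho(X\cup\{y\})=\rho(X)\}$; $\mathcal{L}_\rho$ the lattice of closed sets ($X=\sigma_\rho(X)$) under inclusion. $\rho$ is a representation of $\Lambda$ if $\Lambda=\{x_1\cdots x_k:\rho(\{x_1,\dots,x_i\})=i\ \forall i\le k\}$. It is aligned if there is an order preserving $\varphi:\mathcal{L}_\Lambda\to\mathcal{L}_\rho$ ($F\sqsubset F'\Rightarrow\varphi(F)\subsetneq\varphi(F')$) with $\rho(\tilde\alpha)=\rho(\varphi[\alpha])$, $\tilde\alpha\subseteq\varphi[\alpha]$ for all $\alpha\in\Lambda$, and $F\prec F'\Rightarrow\varphi(F)\prec\varphi(F')$. -}

module Defs where

open import Level using (0ℓ)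
open import Data.Nat using (ℕ; zero; suc) renaming (_≤_ to _≤ℕ_; _<_ to _<ℕ_)
open import Data.Fin using (Fin)
open import Data.Fin.Subset
  using (Subset; ⊥; ⁅_⁆; _∪_; _∩_; _⊆_; _⊂_)
  renaming (_∈_ to _∈ₛ_; _∉_ to _∉ₛ_)
open import Data.List using (List; []; _∷_; _++_; [_]; length; take)
open import Data.List.Membership.Propositional using (_∈_)
open import Data.List.Relation.Unary.Unique.Propositional using (Unique)
open import Data.Bool using (Bool; T)
open import Data.Product using (Σ; ∃; _×_; _,_)
open import Relation.Nullary using (¬_)
open import Relation.Binary.PropositionalEquality using (_≡_; _≢_)
open import Relation.Binary.Structures using (IsTotalOrder)
open import Algebra.Structures using (IsCommutativeRing)
open import Function.Bundles using (_⇔_)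

-- Value domain of polymatroid rank functions.
-- The paper uses ℝ; agda-stdlib has no reals, so we quantify over an
-- arbitrary totally ordered field (ℝ is one instance).

record OrderedField : Set₁ where
  infixl 6 _+_
  infixl 7 _*_
  infix  4 _≤_
  field
    Carrier : Set
    _+_ _*_ : Carrier → Carrier → Carrier
    -_      : Carrier → Carrier
    0# 1#   : Carrier
    _≤_     : Carrier → Carrier → Set
    isCommutativeRing : IsCommutativeRing _≡_ _+_ _*_ -_ 0# 1#
    isTotalOrder      : IsTotalOrder _≡_ _≤_
    +-mono-≤  : ∀ {x y} z → x ≤ y → x + z ≤ y + z
    *-nonneg  : ∀ {x y} → 0# ≤ x → 0# ≤ y → 0# ≤ x * y
    0≢1       : 0# ≢ 1#
    inverse   : ∀ x → x ≢ 0# → ∃ λ y → x * y ≡ 1#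

  ι : ℕ → Carrier
  ι zero    = 0#
  ι (suc i) = ι i + 1#

Word : ℕ → Set
Word n = List (Fin n)

Language : ℕ → Set
Language n = Word n → Bool

module _ {n : ℕ} (Λ : Language n) where

  In : Word n → Set
  In w = T (Λ w)

  letters : Word n → Subset n
  letters []      = ⊥
  letters (x ∷ α) = ⁅ x ⁆ ∪ letters α

  record IsGreedoid : Set where
    field
      nonempty   : ∃ λ w → In w
      simple     : ∀ w → In w → Unique w
      hereditary : ∀ α β → In (α ++ β) → In α
      exchange   : ∀ α β → In α → In β → length β <ℕ length α →
                   ∃ λ x → x ∈ α × In (β ++ [ x ])

  IsNormal : Set
  IsNormal = ∀ (x : Fin n) → ∃ λ w → In w × x ∈ w

  IsRank : Subset n → ℕ → Set
  IsRank X k =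
    (∃ λ β → In β × letters β ⊆ X × length β ≡ k) ×
    (∀ β → In β → letters β ⊆ X → length β ≤ℕ k)

  InGSpan : Subset n → Fin n → Set
  InGSpan X y = ∀ k k' → IsRank X k → IsRank (X ∪ ⁅ y ⁆) k' → k ≡ k'

  InKernel : Subset n → Fin n → Set
  InKernel X y =
    ∃ λ β → In β × (∀ z → z ∈ β → InGSpan X z) × y ∈ β

  -- flats: α ∼ β iff Γ[α] = Γ[β]
  _∼_ : Word n → Word n → Set
  α ∼ β = ∀ x → In (α ++ [ x ]) ⇔ In (β ++ [ x ])

  _⊏_ : Word n → Word n → Set
  α ⊏ β = ∃ λ β' → β' ≢ [] × In (α ++ β') × (α ++ β') ∼ β

  _≺_ : Word n → Word n → Set
  α ≺ β = α ⊏ β × ¬ (∃ λ γ → In γ × α ⊏ γ × γ ⊏ β)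

module _ {n : ℕ} (F : OrderedField) where
  open OrderedField F

  record IsPolymatroid (ρ : Subset n → Carrier) : Set where
    field
      empty      : ρ ⊥ ≡ 0#
      monotone   : ∀ X Y → X ⊆ Y → ρ X ≤ ρ Y
      submodular : ∀ X Y → ρ (X ∪ Y) + ρ (X ∩ Y) ≤ ρ X + ρ Y

  module _ (ρ : Subset n → Carrier) where

    InPSpan : Subset n → Fin n → Set
    InPSpan X y = ρ (X ∪ ⁅ y ⁆) ≡ ρ X

    Closed : Subset n → Set
    Closed X = ∀ y → (y ∈ₛ X ⇔ InPSpan X y)

    _≺ρ_ : Subset n → Subset n → Set
    X ≺ρ Y = X ⊂ Y × ¬ (∃ λ Z → Closed Z × X ⊂ Z × Z ⊂ Y)

    IsRepresentation : Language n → Set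
    IsRepresentation Λ = ∀ w →
      In Λ w ⇔ (∀ i → i ≤ℕ length w → ρ (letters Λ (take i w)) ≡ ι i)

    -- aligned: φ : 𝓛_Λ → 𝓛_ρ given on representatives α ∈ Λ of flats
    record IsAlignedVia (Λ : Language n) (φ : Word n → Subset n) : Set where
      field
        wellDefined : ∀ α β → In Λ α → In Λ β → _∼_ Λ α β → φ α ≡ φ β
        closed      : ∀ α → In Λ α → Closed (φ α)
        orderPres   : ∀ α β → In Λ α → In Λ β → _⊏_ Λ α β → φ α ⊂ φ β
        sameRank    : ∀ α → In Λ α → ρ (letters Λ α) ≡ ρ (φ α)
        contains    : ∀ α → In Λ α → letters Λ α ⊆ φ α
        coverPres   : ∀ α β → In Λ α → In Λ β → _≺_ Λ α β → φ α ≺ρ φ β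

    IsAligned : Language n → Set
    IsAligned Λ = ∃ λ φ → IsAlignedVia Λ φ

{-# OPTIONS --safe #-}
module Submission where

-- Extend α to a maximal word αβ₀. All maximal words have the same flat, which contains
-- every letter, so y ∈ φ[αβ₀]; and y ∉ φ[α], for otherwise the first prefix of α whose
-- flat contains y would give a word of κ[α] ending in y. Let pa be the first prefix of αβ₀
-- beyond α with y ∈ φ[pa]. As [p] ≺ [pa] and φ preserves covers, the ρ-closure of p̃ ∪ {y},
-- which lies strictly above φ[p] and inside φ[pa], is φ[pa]; so ρ(p̃ ∪ {y}) = |p| + 1 and
-- py ∈ Λ by the representation.

open import Defs
open import Data.Nat using (ℕ)
open import Data.Fin using (Fin)
open import Data.List using (_++_; [_])
open import Data.Fin.Subset using (Subset)
open import Data.Product using (∃; _×_)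
open import Relation.Nullary using (¬_)

open import Algebra.Bundles using (Ring)
import Algebra.Properties.Ring as RingProperties
open import Algebra.Structures using (IsCommutativeRing)
open import Data.Empty using (⊥-elim)
import Data.Fin.Properties as Finₚ
import Data.Fin as Fin
open import Data.Fin.Subset using (⁅_⁆; _∪_; _⊆_; _⊂_)
  renaming (_∈_ to _∈ₛ_; _∉_ to _∉ₛ_)
open import Data.Fin.Subset.Properties
  using (_∈?_; ⊥⊆; x∈p∪q⁻; x∈p∩q⁺; p⊆p∪q; q⊆p∪q; x∈⁅y⁆⇒x≡y; x∈⁅x⁆; ⊆-refl; ⊆-trans;
         ∪-assoc; ∪-identityˡ; ∪-identityʳ)
open import Data.List using (List; []; _∷_; length; take; filter; lookup; allFin)
open import Data.List.Properties using (++-identityʳ; ∷ʳ-++; length-++; take-all)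
open import Data.List.Membership.Propositional using (_∈_)
open import Data.List.Membership.Propositional.Properties
  using (∈-∃++; ∈-++⁻; ∈-++⁺ˡ; ∈-++⁺ʳ; ∈-filter⁺; ∈-allFin; ∈-lookup)
open import Data.List.Relation.Binary.Subset.Propositional using () renaming (_⊆_ to _⊆ₗ_)
open import Data.List.Relation.Binary.Subset.Propositional.Properties using (∷⁺ʳ)
open import Data.List.Relation.Unary.All as All using (All; []; _∷_)
open import Data.List.Relation.Unary.All.Properties using (all-filter)
open import Data.List.Relation.Unary.Any using (here; there)
open import Data.List.Relation.Unary.AllPairs using (_∷_)
open import Data.List.Relation.Unary.Unique.Propositional using (Unique)
import Data.Nat as ℕ
open import Data.Nat using (zero; suc; z≤n; s≤s)
import Data.Nat.Properties as ℕₚ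
open import Data.Product using (_,_; proj₁)
open import Data.Sum using (inj₁; inj₂)
open import Data.Vec using (tabulate)
open import Data.Vec.Properties using (lookup∘tabulate; []=⇒lookup; lookup⇒[]=)
open import Effect.Monad using (RawMonad)
open import Function using (_∘_)
open import Function.Bundles using (Equivalence; mk⇔)
open import Function.Definitions using (Injective)
open import Relation.Binary.PropositionalEquality
  using (_≡_; _≢_; refl; sym; trans; cong; subst; subst₂; module ≡-Reasoning)
open import Relation.Binary.Structures using (IsTotalOrder)
open import Relation.Nullary using (Dec; yes; no; does; contradiction)
open import Relation.Nullary.Decidable using (T?; dec-true; decidable-stable; ¬¬-excluded-middle)
open import Relation.Nullary.Negation using (¬¬-Monad)

module OrderedFieldProperties (F : OrderedField) where

  open OrderedField F
  open IsCommutativeRing isCommutativeRing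
    using (isRing; +-assoc; +-comm; +-identityˡ; +-identityʳ; -‿inverseʳ)
  open IsTotalOrder isTotalOrder public
    using (total; antisym) renaming (refl to ≤-refl; trans to ≤-trans; reflexive to ≤-reflexive)

  private
    ring : Ring _ _
    ring = record { isRing = isRing }

  open RingProperties ring using (-1*x≈-x; -‿involutive)

  +-cancelʳ-≤ : ∀ {x y} c → x + c ≤ y + c → x ≤ y
  +-cancelʳ-≤ {x} {y} c x+c≤y+c = subst₂ _≤_ (cancel x) (cancel y) (+-mono-≤ (- c) x+c≤y+c)
    where
    cancel : ∀ z → z + c + - c ≡ z
    cancel z = trans (+-assoc z c (- c)) (trans (cong (z +_) (-‿inverseʳ c)) (+-identityʳ z))

  +-cancelʳ-≡ : ∀ {x y} c → x + c ≡ y + c → x ≡ y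
  +-cancelʳ-≡ c eq = antisym (+-cancelʳ-≤ c (≤-reflexive eq)) (+-cancelʳ-≤ c (≤-reflexive (sym eq)))

  +-monoʳ-≤ : ∀ {x y} c → x ≤ y → c + x ≤ c + y
  +-monoʳ-≤ {x} {y} c x≤y = subst₂ _≤_ (+-comm x c) (+-comm y c) (+-mono-≤ c x≤y)

  0≤1 : 0# ≤ 1#
  0≤1 with total 0# 1#
  ... | inj₁ 0≤1 = 0≤1
  ... | inj₂ 1≤0 = contradiction (antisym 0≤[-1]² 1≤0) 0≢1
    where
    0≤-1 : 0# ≤ - 1#
    0≤-1 = subst₂ _≤_ (-‿inverseʳ 1#) (+-identityˡ (- 1#)) (+-mono-≤ (- 1#) 1≤0)
    0≤[-1]² : 0# ≤ 1#
    0≤[-1]² = subst (0# ≤_) (trans (-1*x≈-x (- 1#)) (-‿involutive 1#)) (*-nonneg 0≤-1 0≤-1)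

  x≤x+1 : ∀ x → x ≤ x + 1#
  x≤x+1 x = subst (_≤ x + 1#) (+-identityʳ x) (+-monoʳ-≤ x 0≤1)

  x+1≢x : ∀ x → x + 1# ≢ x
  x+1≢x x x+1≡x = 0≢1 (sym (+-cancelʳ-≡ x 1+x≡0+x))
    where
    open ≡-Reasoning
    1+x≡0+x : 1# + x ≡ 0# + x
    1+x≡0+x = begin
      1# + x ≡⟨ +-comm 1# x ⟩
      x + 1# ≡⟨ x+1≡x ⟩
      x      ≡⟨ +-identityˡ x ⟨
      0# + x ∎

  ι-mono-≤ : ∀ {m n} → m ℕ.≤ n → ι m ≤ ι n
  ι-mono-≤ {zero}  {zero}  z≤n       = ≤-refl
  ι-mono-≤ {zero}  {suc n} z≤n       = ≤-trans (ι-mono-≤ {zero} {n} z≤n) (x≤x+1 (ι n))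
  ι-mono-≤ {suc m} {suc n} (s≤s m≤n) = +-mono-≤ 1# (ι-mono-≤ m≤n)

  ι-cancel-≤ : ∀ {m n} → ι m ≤ ι n → m ℕ.≤ n
  ι-cancel-≤ {m} {n} ιm≤ιn with ℕₚ.≤-<-connex m n
  ... | inj₁ m≤n = m≤n
  ... | inj₂ n<m =
    contradiction (antisym (≤-trans (ι-mono-≤ n<m) ιm≤ιn) (x≤x+1 (ι n))) (x+1≢x (ι n))

module _ {n : ℕ} where

  select : {P : Fin n → Set} → (∀ x → Dec (P x)) → Subset n
  select P? = tabulate (λ x → does (P? x))

  ∈-select⁺ : ∀ {P : Fin n → Set} (P? : ∀ x → Dec (P x)) {x} → P x → x ∈ₛ select P?
  ∈-select⁺ P? {x} px =
    lookup⇒[]= x (select P?) (trans (lookup∘tabulate (λ x → does (P? x)) x) (dec-true (P? x) px))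

  ∈-select⁻ : ∀ {P : Fin n → Set} (P? : ∀ x → Dec (P x)) {x} → x ∈ₛ select P? → P x
  ∈-select⁻ P? {x} x∈
    with P? x | trans (sym (lookup∘tabulate (λ x → does (P? x)) x)) ([]=⇒lookup x∈)
  ... | yes px | _ = px
  ... | no _   | ()

  ∪-lub : ∀ {A B C : Subset n} → A ⊆ C → B ⊆ C → A ∪ B ⊆ C
  ∪-lub {A} {B} A⊆C B⊆C x∈A∪B with x∈p∪q⁻ A B x∈A∪B
  ... | inj₁ x∈A = A⊆C x∈A
  ... | inj₂ x∈B = B⊆C x∈B

  x∈p⇒⁅x⁆⊆p : ∀ {x} {p : Subset n} → x ∈ₛ p → ⁅ x ⁆ ⊆ p
  x∈p⇒⁅x⁆⊆p {x} x∈p y∈⁅x⁆ = subst (_∈ₛ _) (sym (x∈⁅y⁆⇒x≡y x y∈⁅x⁆)) x∈p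

  _∪⁅_⁆* : Subset n → List (Fin n) → Subset n
  X ∪⁅ []     ⁆* = X
  X ∪⁅ z ∷ zs ⁆* = (X ∪ ⁅ z ⁆) ∪⁅ zs ⁆*

  ⊆-∪⁅⁆* : ∀ {X} zs → X ⊆ X ∪⁅ zs ⁆*
  ⊆-∪⁅⁆* []       = λ x∈X → x∈X
  ⊆-∪⁅⁆* (z ∷ zs) = ⊆-trans (p⊆p∪q ⁅ z ⁆) (⊆-∪⁅⁆* zs)

  ∈-∪⁅⁆* : ∀ {X z zs} → z ∈ zs → z ∈ₛ X ∪⁅ zs ⁆*
  ∈-∪⁅⁆* {X} {z} {z ∷ zs} (here refl) = ⊆-∪⁅⁆* zs (q⊆p∪q X ⁅ z ⁆ (x∈⁅x⁆ z))
  ∈-∪⁅⁆* {_} {_} {_ ∷ zs} (there z∈zs) = ∈-∪⁅⁆* z∈zs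

¬¬-decidable : ∀ {m} {P : Fin m → Set} → ¬ ¬ (∀ x → Dec (P x))
¬¬-decidable = Finₚ.sequence (RawMonad.rawApplicative ¬¬-Monad) (λ _ → ¬¬-excluded-middle)

lookup-injective : ∀ {A : Set} {xs : List A} → Unique xs → Injective _≡_ _≡_ (lookup xs)
lookup-injective {xs = _ ∷ _} _ {Fin.zero} {Fin.zero} _ = refl
lookup-injective (x∉ ∷ _) {Fin.zero} {Fin.suc j} eq =
  contradiction eq (All.lookup x∉ (∈-lookup j))
lookup-injective (x∉ ∷ _) {Fin.suc i} {Fin.zero} eq =
  contradiction (sym eq) (All.lookup x∉ (∈-lookup i))
lookup-injective (_ ∷ xs!) {Fin.suc i} {Fin.suc j} eq = cong Fin.suc (lookup-injective xs! eq)

Unique⇒length≤ : ∀ {n} {xs : List (Fin n)} → Unique xs → length xs ℕ.≤ n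
Unique⇒length≤ xs! = Finₚ.injective⇒≤ (lookup-injective xs!)

length-++-[] : ∀ {A : Set} (xs : List A) x → length (xs ++ [ x ]) ≡ suc (length xs)
length-++-[] xs x = trans (length-++ xs) (ℕₚ.+-comm (length xs) 1)

take-++ˡ : ∀ {A : Set} {i} (xs ys : List A) → i ℕ.≤ length xs → take i (xs ++ ys) ≡ take i xs
take-++ˡ {i = zero}  _        _  _         = refl
take-++ˡ {i = suc i} (x ∷ xs) ys (s≤s i≤) = cong (x ∷_) (take-++ˡ xs ys i≤)

module PolymatroidProperties {n : ℕ} (F : OrderedField) (ρ : Subset n → OrderedField.Carrier F)
                             (polymatroid : IsPolymatroid F ρ) where

  open OrderedField F
  open OrderedFieldProperties F
  open IsPolymatroid polymatroid

  InSpan : Subset n → Fin n → Set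
  InSpan = InPSpan F ρ

  ρ-mono : ∀ {X Y} → X ⊆ Y → ρ X ≤ ρ Y
  ρ-mono = monotone _ _

  ρ-squeeze : ∀ {X Y Z} → X ⊆ Y → Y ⊆ Z → ρ Z ≤ ρ X → ρ Y ≡ ρ X
  ρ-squeeze X⊆Y Y⊆Z ρZ≤ρX = antisym (≤-trans (ρ-mono Y⊆Z) ρZ≤ρX) (ρ-mono X⊆Y)

  ρ-∪-absorb : ∀ {S A B} → S ⊆ A → S ⊆ B → ρ B ≡ ρ S → ρ (A ∪ B) ≤ ρ A
  ρ-∪-absorb {S} {A} {B} S⊆A S⊆B ρB≡ρS = +-cancelʳ-≤ (ρ S)
    (≤-trans (+-monoʳ-≤ (ρ (A ∪ B)) (ρ-mono (λ x∈S → x∈p∩q⁺ (S⊆A x∈S , S⊆B x∈S))))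
      (≤-trans (submodular A B) (≤-reflexive (cong (ρ A +_) ρB≡ρS))))

  ∈⇒InSpan : ∀ {X z} → z ∈ₛ X → InSpan X z
  ∈⇒InSpan z∈X = ρ-squeeze (p⊆p∪q _) (∪-lub ⊆-refl (x∈p⇒⁅x⁆⊆p z∈X)) ≤-refl

  InSpan-mono : ∀ {S A z} → S ⊆ A → InSpan S z → InSpan A z
  InSpan-mono {S} {A} {z} S⊆A z∈σS = ρ-squeeze (p⊆p∪q _)
    (∪-lub (p⊆p∪q _) (⊆-trans (q⊆p∪q S ⁅ z ⁆) (q⊆p∪q A _)))
    (ρ-∪-absorb S⊆A (p⊆p∪q _) z∈σS)

  ρ-∪⁅⁆* : ∀ {S X} zs → S ⊆ X → ρ X ≡ ρ S → All (InSpan S) zs → ρ (X ∪⁅ zs ⁆*) ≡ ρ S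
  ρ-∪⁅⁆* []       _   ρX≡ρS []              = ρX≡ρS
  ρ-∪⁅⁆* (z ∷ zs) S⊆X ρX≡ρS (z∈σS ∷ zs⊆σS) =
    ρ-∪⁅⁆* zs (⊆-trans S⊆X (p⊆p∪q _)) (trans (InSpan-mono S⊆X z∈σS) ρX≡ρS) zs⊆σS

  ρ-spanned : ∀ {S T} → S ⊆ T → (∀ {z} → z ∈ₛ T → InSpan S z) → ρ T ≡ ρ S
  ρ-spanned {S} {T} S⊆T T⊆σS = ρ-squeeze S⊆T T⊆S∪zs
    (≤-reflexive (ρ-∪⁅⁆* zs ⊆-refl refl (All.map T⊆σS (all-filter (_∈? T) (allFin n)))))
    where
    zs : List (Fin n)
    zs = filter (_∈? T) (allFin n)
    T⊆S∪zs : T ⊆ S ∪⁅ zs ⁆*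
    T⊆S∪zs z∈T = ∈-∪⁅⁆* (∈-filter⁺ (_∈? T) (∈-allFin _) z∈T)

  closed-⊂⇒ρ≢ : ∀ {A B} → Closed F ρ A → A ⊂ B → ρ A ≢ ρ B
  closed-⊂⇒ρ≢ A-closed (A⊆B , x , x∈B , x∉A) ρA≡ρB = x∉A (Equivalence.from (A-closed x)
    (ρ-squeeze (p⊆p∪q _) (∪-lub A⊆B (x∈p⇒⁅x⁆⊆p x∈B)) (≤-reflexive (sym ρA≡ρB))))

  ≺ρ-no-intermediate : ∀ {X Y Z} → _≺ρ_ F ρ X Y → Closed F ρ Z → X ⊂ Z → Z ⊆ Y → Y ⊆ Z
  ≺ρ-no-intermediate {Z = Z} (_ , no-mid) Z-closed X⊂Z Z⊆Y {x} x∈Y with x ∈? Z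
  ... | yes x∈Z = x∈Z
  ... | no x∉Z  = ⊥-elim (no-mid (Z , Z-closed , X⊂Z , Z⊆Y , x , x∈Y , x∉Z))

  module Closure (K : Subset n) (span? : ∀ z → Dec (InSpan K z)) where

    closure : Subset n
    closure = select span?

    ⊆-closure : K ⊆ closure
    ⊆-closure z∈K = ∈-select⁺ span? (∈⇒InSpan z∈K)

    ρ-closure : ρ closure ≡ ρ K
    ρ-closure = ρ-spanned ⊆-closure (∈-select⁻ span?)

    closure-closed : Closed F ρ closure
    closure-closed z = mk⇔ ∈⇒InSpan λ z∈σE → ∈-select⁺ span?
      (ρ-squeeze (p⊆p∪q _) (∪-lub (⊆-trans ⊆-closure (p⊆p∪q _)) (q⊆p∪q _ _))
                 (≤-reflexive (trans z∈σE ρ-closure)))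

    closure-least : ∀ {C} → K ⊆ C → Closed F ρ C → closure ⊆ C
    closure-least K⊆C C-closed {z} z∈E =
      Equivalence.from (C-closed z) (InSpan-mono K⊆C (∈-select⁻ span? z∈E))

module Words {n : ℕ} (Λ : Language n) where

  letters-++-[] : ∀ p y → letters Λ (p ++ [ y ]) ≡ letters Λ p ∪ ⁅ y ⁆
  letters-++-[] []      y = trans (∪-identityʳ ⁅ y ⁆) (sym (∪-identityˡ ⁅ y ⁆))
  letters-++-[] (x ∷ p) y =
    trans (cong (⁅ x ⁆ ∪_) (letters-++-[] p y)) (sym (∪-assoc ⁅ x ⁆ (letters Λ p) ⁅ y ⁆))

  ∈⇒∈letters : ∀ {x w} → x ∈ w → x ∈ₛ letters Λ w
  ∈⇒∈letters {x} {_ ∷ w} (here refl) = p⊆p∪q (letters Λ w) (x∈⁅x⁆ x)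
  ∈⇒∈letters {_} {y ∷ _} (there x∈w) = q⊆p∪q ⁅ y ⁆ _ (∈⇒∈letters x∈w)

  Maximal : Word n → Set
  Maximal w = ∀ x → ¬ In Λ (w ++ [ x ])

  maximal-∼ : ∀ {u w} → Maximal u → Maximal w → _∼_ Λ u w
  maximal-∼ u-max w-max x = mk⇔ (⊥-elim ∘ u-max x) (⊥-elim ∘ w-max x)

  maximal-extension : IsGreedoid Λ → ∀ u → In Λ u → ∃ λ v → In Λ (u ++ v) × Maximal (u ++ v)
  maximal-extension greedoid u u∈Λ = go n u u∈Λ (ℕₚ.m≤m+n n (length u))
    where
    open IsGreedoid greedoid
    stop : ∀ {u} → In Λ u → Maximal u → ∃ λ v → In Λ (u ++ v) × Maximal (u ++ v)
    stop {u} u∈Λ u-max =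
      [] , subst (λ w → In Λ w × Maximal w) (sym (++-identityʳ u)) (u∈Λ , u-max)
    go : ∀ slack u → In Λ u → n ℕ.≤ slack ℕ.+ length u →
         ∃ λ v → In Λ (u ++ v) × Maximal (u ++ v)
    go zero u u∈Λ n≤u = stop u∈Λ λ x ux∈Λ → ℕₚ.1+n≰n (ℕₚ.≤-trans
      (subst (ℕ._≤ n) (length-++-[] u x) (Unique⇒length≤ (simple _ ux∈Λ))) n≤u)
    go (suc slack) u u∈Λ n≤ with Finₚ.any? (λ x → T? (Λ (u ++ [ x ])))
    ... | no stuck = stop u∈Λ λ x ux∈Λ → stuck (x , ux∈Λ)
    ... | yes (x , ux∈Λ) with go slack (u ++ [ x ]) ux∈Λ
          (subst (λ k → n ℕ.≤ slack ℕ.+ k) (sym (length-++-[] u x))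
                 (subst (n ℕ.≤_) (sym (ℕₚ.+-suc slack (length u))) n≤))
    ...   | v , uxv∈Λ , uxv-max =
      x ∷ v , subst (λ w → In Λ w × Maximal w) (∷ʳ-++ u x v) (uxv∈Λ , uxv-max)

module AlignedRepresentation
  {n : ℕ} (F : OrderedField) (Λ : Language n) (ρ : Subset n → OrderedField.Carrier F)
  (greedoid : IsGreedoid Λ) (polymatroid : IsPolymatroid F ρ)
  (representation : IsRepresentation F ρ Λ)
  (φ : Word n → Subset n) (aligned : IsAlignedVia F ρ Λ φ) where

  open OrderedField F
  open OrderedFieldProperties F
  open PolymatroidProperties F ρ polymatroid
  open Words Λ
  open IsGreedoid greedoid
  open IsAlignedVia aligned

  private
    L : Word n → Subset n
    L = letters Λ

  ρ-letters : ∀ {w} → In Λ w → ρ (L w) ≡ ι (length w)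
  ρ-letters {w} w∈Λ = subst (λ u → ρ (L u) ≡ ι (length w)) (take-all (length w) w ℕₚ.≤-refl)
    (Equivalence.to (representation w) w∈Λ (length w) ℕₚ.≤-refl)

  ρφ : ∀ {w} → In Λ w → ρ (φ w) ≡ ι (length w)
  ρφ w∈Λ = trans (sym (sameRank _ w∈Λ)) (ρ-letters w∈Λ)

  ++-[]-∈ : ∀ {p y} → In Λ p → ρ (L p ∪ ⁅ y ⁆) ≡ ι (suc (length p)) → In Λ (p ++ [ y ])
  ++-[]-∈ {p} {y} p∈Λ ρpy = Equivalence.from (representation (p ++ [ y ])) prefix-ranks
    where
    open ≡-Reasoning
    prefix-ranks : ∀ i → i ℕ.≤ length (p ++ [ y ]) → ρ (L (take i (p ++ [ y ]))) ≡ ι i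
    prefix-ranks i i≤ with i ℕ.≤? length p
    ... | yes i≤p =
      trans (cong (ρ ∘ L) (take-++ˡ p [ y ] i≤p)) (Equivalence.to (representation p) p∈Λ i i≤p)
    ... | no i≰p with ℕₚ.≤-antisym i≤ (subst (ℕ._≤ i) (sym (length-++-[] p y)) (ℕₚ.≰⇒> i≰p))
    ...   | refl = begin
      ρ (L (take (length (p ++ [ y ])) (p ++ [ y ])))
        ≡⟨ cong (ρ ∘ L) (take-all _ (p ++ [ y ]) ℕₚ.≤-refl) ⟩
      ρ (L (p ++ [ y ]))                               ≡⟨ cong ρ (letters-++-[] p y) ⟩
      ρ (L p ∪ ⁅ y ⁆)                                  ≡⟨ ρpy ⟩
      ι (suc (length p))                               ≡⟨ cong ι (length-++-[] p y) ⟨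
      ι (length (p ++ [ y ]))                          ∎

  InSpan⇒++-[]-∉ : ∀ {p y} → In Λ p → InSpan (L p) y → ¬ In Λ (p ++ [ y ])
  InSpan⇒++-[]-∉ {p} {y} p∈Λ y∈σp py∈Λ = x+1≢x (ι (length p)) (begin
    ι (length p) + 1#        ≡⟨ cong ι (length-++-[] p y) ⟨
    ι (length (p ++ [ y ]))  ≡⟨ ρ-letters py∈Λ ⟨
    ρ (L (p ++ [ y ]))       ≡⟨ cong ρ (letters-++-[] p y) ⟩
    ρ (L p ∪ ⁅ y ⁆)          ≡⟨ y∈σp ⟩
    ρ (L p)                  ≡⟨ ρ-letters p∈Λ ⟩
    ι (length p)             ∎)
    where open ≡-Reasoning

  φ⊆InSpan : ∀ {α y} → In Λ α → y ∈ₛ φ α → InSpan (L α) y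
  φ⊆InSpan {α} α∈Λ y∈φα = ρ-squeeze (p⊆p∪q _) (∪-lub (contains α α∈Λ) (x∈p⇒⁅x⁆⊆p y∈φα))
    (≤-reflexive (sym (sameRank α α∈Λ)))

  InSpan⇒InGSpan : ∀ {α z} → In Λ α → InSpan (L α) z → InGSpan Λ (L α) z
  InSpan⇒InGSpan {α} {z} α∈Λ z∈σα k k′
                 ((β , β∈Λ , β⊆α , refl) , k-max) ((γ , γ∈Λ , γ⊆αz , refl) , k′-max) =
    ℕₚ.≤-antisym (k′-max β β∈Λ (⊆-trans β⊆α (p⊆p∪q _)))
                 (ℕₚ.≤-trans |γ|≤|α| (k-max α α∈Λ ⊆-refl))
    where
    |γ|≤|α| : length γ ℕ.≤ length α
    |γ|≤|α| = ι-cancel-≤ (subst₂ _≤_ (ρ-letters γ∈Λ) (trans z∈σα (ρ-letters α∈Λ)) (ρ-mono γ⊆αz))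

  ⊏⇒length< : ∀ {α β} → In Λ α → In Λ β → _⊏_ Λ α β → length α ℕ.< length β
  ⊏⇒length< {α} {β} α∈Λ β∈Λ α⊏β = ℕₚ.≤∧≢⇒<
    (ι-cancel-≤ (subst₂ _≤_ (ρφ α∈Λ) (ρφ β∈Λ) (ρ-mono (proj₁ φα⊂φβ))))
    (λ |α|≡|β| → closed-⊂⇒ρ≢ (closed α α∈Λ) φα⊂φβ
      (trans (ρφ α∈Λ) (trans (cong ι |α|≡|β|) (sym (ρφ β∈Λ)))))
    where
    φα⊂φβ : φ α ⊂ φ β
    φα⊂φβ = orderPres α β α∈Λ β∈Λ α⊏β

  ≺-++-[] : ∀ {p a} → In Λ p → In Λ (p ++ [ a ]) → _≺_ Λ p (p ++ [ a ])
  ≺-++-[] {p} {a} p∈Λ pa∈Λ = ([ a ] , (λ ()) , pa∈Λ , λ _ → mk⇔ (λ q → q) (λ q → q)) , no-mid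
    where
    no-mid : ¬ (∃ λ γ → In Λ γ × _⊏_ Λ p γ × _⊏_ Λ γ (p ++ [ a ]))
    no-mid (γ , γ∈Λ , p⊏γ , γ⊏pa) = ℕₚ.<⇒≱ (⊏⇒length< p∈Λ γ∈Λ p⊏γ)
      (ℕₚ.<⇒≤pred (subst (length γ ℕ.<_) (length-++-[] p a) (⊏⇒length< γ∈Λ pa∈Λ γ⊏pa)))

  enters-flat⇒++-[]-∈ : ∀ {p a y} → In Λ p → In Λ (p ++ [ a ]) →
                   y ∈ₛ φ (p ++ [ a ]) → y ∉ₛ φ p → In Λ (p ++ [ y ])
  enters-flat⇒++-[]-∈ {p} {a} {y} p∈Λ pa∈Λ y∈φpa y∉φp =
    -- The closure of K needs ρ-span membership to be decidable, which we only have under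
    -- double negation; that is enough because membership in Λ is decidable.
    decidable-stable (T? (Λ (p ++ [ y ])))
      (λ py∉Λ → ¬¬-decidable (λ span? → py∉Λ (++-[]-∈ p∈Λ (ρK≡ρφpa span?))))
    where
    K : Subset n
    K = L p ∪ ⁅ y ⁆
    p≺pa : _≺_ Λ p (p ++ [ a ])
    p≺pa = ≺-++-[] p∈Λ pa∈Λ
    K⊆φpa : K ⊆ φ (p ++ [ a ])
    K⊆φpa = ∪-lub (⊆-trans (contains p p∈Λ) (proj₁ (orderPres p _ p∈Λ pa∈Λ (proj₁ p≺pa))))
                  (x∈p⇒⁅x⁆⊆p y∈φpa)
    ρK≡ρφpa : (∀ z → Dec (InSpan K z)) → ρ K ≡ ι (suc (length p))
    ρK≡ρφpa span? =
      trans (antisym (ρ-mono K⊆φpa) ρφpa≤ρK) (trans (ρφ pa∈Λ) (cong ι (length-++-[] p a)))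
      where
      open Closure K span?
      φp⊂closure : φ p ⊂ closure
      φp⊂closure = (λ z∈φp → ∈-select⁺ span? (InSpan-mono (p⊆p∪q _) (φ⊆InSpan p∈Λ z∈φp)))
                 , y , ⊆-closure (q⊆p∪q (L p) ⁅ y ⁆ (x∈⁅x⁆ y)) , y∉φp
      ρφpa≤ρK : ρ (φ (p ++ [ a ])) ≤ ρ K
      ρφpa≤ρK = ≤-trans
        (ρ-mono (≺ρ-no-intermediate (coverPres p _ p∈Λ pa∈Λ p≺pa) closure-closed
                   φp⊂closure (closure-least K⊆φpa (closed _ pa∈Λ))))
        (≤-reflexive ρ-closure)

  extend-within : ∀ {y} γ δ → In Λ (γ ++ δ) → y ∉ₛ φ γ → y ∈ₛ φ (γ ++ δ) →
                  ∃ λ β → β ⊆ₗ δ × In Λ (γ ++ β ++ [ y ])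
  extend-within γ [] _ y∉φγ y∈φγ =
    contradiction (subst (λ w → _ ∈ₛ φ w) (++-identityʳ γ) y∈φγ) y∉φγ
  extend-within {y} γ (a ∷ δ) γaδ∈Λ y∉φγ y∈φγaδ = step (y ∈? φ (γ ++ [ a ]))
    where
    γa++δ∈Λ : In Λ ((γ ++ [ a ]) ++ δ)
    γa++δ∈Λ = subst (In Λ) (sym (∷ʳ-++ γ a δ)) γaδ∈Λ
    γa∈Λ : In Λ (γ ++ [ a ])
    γa∈Λ = hereditary _ δ γa++δ∈Λ
    step : Dec (y ∈ₛ φ (γ ++ [ a ])) → ∃ λ β → β ⊆ₗ a ∷ δ × In Λ (γ ++ β ++ [ y ])
    step (yes y∈φγa) = [] , (λ ()) , enters-flat⇒++-[]-∈ (hereditary γ [ a ] γa∈Λ) γa∈Λ y∈φγa y∉φγ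
    step (no y∉φγa) with extend-within (γ ++ [ a ]) δ γa++δ∈Λ y∉φγa
                                       (subst (λ w → y ∈ₛ φ w) (sym (∷ʳ-++ γ a δ)) y∈φγaδ)
    ... | β , β⊆δ , γaβy∈Λ =
      a ∷ β , ∷⁺ʳ a β⊆δ , subst (In Λ) (∷ʳ-++ γ a (β ++ [ y ])) γaβy∈Λ

  ∉φ[] : IsNormal Λ → ∀ y → y ∉ₛ φ []
  ∉φ[] normal y y∈φ[] with normal y
  ... | u , u∈Λ , y∈u with ∈-∃++ y∈u
  ...   | δ , rest , refl = InSpan⇒++-[]-∉ δ∈Λ (InSpan-mono ⊥⊆ (φ⊆InSpan []∈Λ y∈φ[])) δy∈Λ
    where
    δy∈Λ : In Λ (δ ++ [ y ])
    δy∈Λ = hereditary _ rest (subst (In Λ) (sym (∷ʳ-++ δ y rest)) u∈Λ)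
    δ∈Λ : In Λ δ
    δ∈Λ = hereditary δ [ y ] δy∈Λ
    []∈Λ : In Λ []
    []∈Λ = hereditary [] δ δ∈Λ

  ∈φ-maximal : IsNormal Λ → ∀ {w} → In Λ w → Maximal w → ∀ y → y ∈ₛ φ w
  ∈φ-maximal normal {w} w∈Λ w-max y with normal y
  ... | u , u∈Λ , y∈u with maximal-extension greedoid u u∈Λ
  ...   | v , uv∈Λ , uv-max = subst (y ∈ₛ_) (wellDefined _ w uv∈Λ w∈Λ (maximal-∼ uv-max w-max))
                                   (contains _ uv∈Λ (∈⇒∈letters (∈-++⁺ˡ y∈u)))

  ∉kernel⇒∉φ : IsNormal Λ → ∀ {α y} → In Λ α → ¬ InKernel Λ (L α) y → y ∉ₛ φ α
  ∉kernel⇒∉φ normal {α} {y} α∈Λ y∉κα y∈φα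
    with extend-within [] α α∈Λ (∉φ[] normal y) y∈φα
  ... | β , β⊆α , βy∈Λ = y∉κα (β ++ [ y ] , βy∈Λ , spanned , ∈-++⁺ʳ β (here refl))
    where
    spanned : ∀ z → z ∈ β ++ [ y ] → InGSpan Λ (L α) z
    spanned z z∈βy with ∈-++⁻ β z∈βy
    ... | inj₁ z∈β        = InSpan⇒InGSpan α∈Λ (∈⇒InSpan (∈⇒∈letters (β⊆α z∈β)))
    ... | inj₂ (here refl) = InSpan⇒InGSpan α∈Λ (φ⊆InSpan α∈Λ y∈φα)

mainTheorem7 : ∀ {n : ℕ} (F : OrderedField) (Λ : Language n)
    (ρ : Subset n → OrderedField.Carrier F) →
    IsGreedoid Λ → IsNormal Λ →
    IsPolymatroid F ρ → IsRepresentation F ρ Λ → IsAligned F ρ Λ →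
    ∀ α → In Λ α → ∀ (y : Fin n) → ¬ InKernel Λ (letters Λ α) y →
    ∃ λ β → In Λ (α ++ β ++ [ y ])
mainTheorem7 F Λ ρ greedoid normal polymatroid representation (φ , aligned) α α∈Λ y y∉κα =
  let β₀ , αβ₀∈Λ , αβ₀-max = maximal-extension greedoid α α∈Λ
      y∉φα = ∉kernel⇒∉φ normal α∈Λ y∉κα
      y∈φαβ₀ = ∈φ-maximal normal αβ₀∈Λ αβ₀-max y
      β , _ , αβy∈Λ = extend-within α β₀ αβ₀∈Λ y∉φα y∈φαβ₀
  in β , αβy∈Λ
  where
  open Words Λ
  open AlignedRepresentation F Λ ρ greedoid polymatroid representation φ aligned
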